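{- Let $m\ge 2$ and $\pi\in W_n^{ -1}(K_{1,m};132)$, and let $y_1,p_1,y_2,p_2,\dots,y_m,p_m,p^*$ be the non-accessory terms of $\pi$ in left-to-right order. For each $1\le i\le m-1$, the accessory terms of $\pi$ lying (in position) between $p_i$ and $y_{i+1}$ are all smaller in value than both $y_i$ and $p_i$, all larger in value than both $y_{i+1}$ and $p_{i+1}$, and appear in decreasing order from left to right.
   Context: For $\pi=\pi_1\cdots\pi_n\in\mathcal{S}_n$, the digraph $D(\pi)$ has vertices $1,\dots,n$ and an arc from $j$ to $i$ whenever $i<j$ and $\pi_i<\pi_j$. The weighted competition graph $W(\pi)$ is the edge-weighted simple graph on the same vertices in which distinct $u,v$ are joined by an edge iff they have a common out-neighbor in $D(\pi)$, with weight equal to the number of common out-neighbors. $K_{1,m}$ is the star with one center and $m$ leaves, all edge weights $1$. $W_n^{ -1}(K_{1,m};132)$ is the set of $132$-avoiding $\pi\in\mathcal{S}_n$ such that $W(\pi)$ is isomorphic, as an edge-weighted graph, to $K_{1,m}$ together with some number of isolated vertices. A term of $\pi$ is an accessory term if it is not part of any occurrence of the pattern $123$ or $132$ in $\pi$. For $\pi\in W_n^{ -1}(K_{1,m};132)$, the subsequence of non-accessory terms has $2m+1$ terms and is order-isomorphic to $(2m-1)(2m)(2m-3)(2m-2)\cdots 3\,4\,1\,2\,(2m+1)$; writing it as $y_1p_1\cdots y_mp_mp^*$, the pair $(y_i,p_i)$ is the $i$-th $(YP)$-pair. -}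

module Defs where

open import Data.Nat using (ℕ; zero; suc; _≤_; _+_; _*_)
open import Data.Fin using (Fin; toℕ; _<_)
open import Data.Fin.Properties using (_<?_)
open import Data.List using (List; length; filter)
open import Data.List.Base using (allFin)
open import Data.Product using (_×_; ∃; Σ; _,_)
open import Data.Sum using (_⊎_)
open import Relation.Nullary using (¬_)
open import Relation.Nullary.Decidable using (_×-dec_)
open import Relation.Binary.PropositionalEquality using (_≡_; _≢_)
open import Function.Definitions using (Injective)

-- A permutation π = π₁⋯πₙ of [n], positions and values are 0-indexed Fin n.
-- An injective self-map of Fin n is a bijection.
IsPerm : {n : ℕ} → (Fin n → Fin n) → Set
IsPerm π = Injective _≡_ _≡_ π

Avoids132 : {n : ℕ} → (Fin n → Fin n) → Set
Avoids132 {n} π = ¬ (Σ (Fin n) λ i → Σ (Fin n) λ j → Σ (Fin n) λ k →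
  i < j × j < k × π i < π k × π k < π j)

-- Arc of D(π) from j to i: i < j and π i < π j.
Arc : {n : ℕ} → (Fin n → Fin n) → Fin n → Fin n → Set
Arc π j i = i < j × π i < π j

-- Weight of {u,v} in W(π): number of common out-neighbours of u and v in D(π).
weight : {n : ℕ} → (Fin n → Fin n) → Fin n → Fin n → ℕ
weight {n} π u v =
  length (filter (λ i → ((i <? u) ×-dec (π i <? π u)) ×-dec ((i <? v) ×-dec (π i <? π v)))
                 (allFin n))

-- Edge weights of K_{1,m} plus isolated vertices on vertex set Fin n:
-- vertex 0 is the centre, vertices 1..m are the leaves (weight 1 edges),
-- all other pairs have weight 0 (non-edges).
data StarEdge (m : ℕ) {n : ℕ} : Fin n → Fin n → Set where
  centre-leaf : ∀ {u v} → toℕ u ≡ 0 → 1 ≤ toℕ v → toℕ v ≤ m → StarEdge m u v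
  leaf-centre : ∀ {u v} → toℕ v ≡ 0 → 1 ≤ toℕ u → toℕ u ≤ m → StarEdge m u v

-- W(π) ≅ K_{1,m} ∪ isolated vertices, as edge-weighted simple graphs:
-- there are enough vertices, and a vertex bijection f such that for all
-- distinct u,v the weight of {u,v} in W(π) equals the weight of {f u, f v}
-- in the star (1 on star edges, 0 = no edge otherwise).
WIsoStar : {n : ℕ} → (Fin n → Fin n) → ℕ → Set
WIsoStar {n} π m = (suc m ≤ n) × (Σ (Fin n → Fin n) λ f → Injective _≡_ _≡_ f ×
  (∀ u v → u ≢ v →
     (StarEdge m (f u) (f v) × weight π u v ≡ 1) ⊎
     (¬ StarEdge m (f u) (f v) × weight π u v ≡ 0)))

InWInvStar132 : {n : ℕ} → ℕ → (Fin n → Fin n) → Set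
InWInvStar132 m π = IsPerm π × Avoids132 π × WIsoStar π m

InOcc123or132 : {n : ℕ} → (Fin n → Fin n) → Fin n → Set
InOcc123or132 {n} π x = Σ (Fin n) λ i → Σ (Fin n) λ j → Σ (Fin n) λ k →
  i < j × j < k ×
  ((π i < π j × π j < π k) ⊎ (π i < π k × π k < π j)) ×
  (x ≡ i ⊎ x ≡ j ⊎ x ≡ k)

Accessory : {n : ℕ} → (Fin n → Fin n) → Fin n → Set
Accessory π x = ¬ InOcc123or132 π x

module Submission where

open import Defs
open import Data.Nat using (ℕ; _≤_; _+_; _*_; _∸_)
open import Data.Fin using (Fin; toℕ; _<_)
open import Data.Product using (_×_; ∃)
open import Relation.Nullary using (¬_)
open import Relation.Binary.PropositionalEquality using (_≡_)
open import Function.Bundles using (_⇔_)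

import Data.Nat as ℕ
open import Data.Nat using (suc; zero; z≤n; s≤s)
import Data.Nat.Properties as ℕP
open import Data.Fin using (fromℕ<) renaming (zero to fzero; suc to fsuc)
import Data.Fin.Properties as FP
open import Data.Fin.Properties using (_<?_; any?; _≟_; pigeonhole)
open import Data.Product using (Σ; _,_; proj₁; proj₂)
open import Data.Sum using (_⊎_; inj₁; inj₂)
open import Data.Empty using (⊥; ⊥-elim)
open import Data.List using (List; length)
open import Data.List.Membership.Propositional using (_∈_)
open import Data.List.Membership.Propositional.Properties using (∈-allFin; ∈-filter⁺)
open import Data.List.Relation.Unary.Any using (here; there)
open import Relation.Nullary using (Dec; yes; no)
open import Relation.Nullary.Decidable using (_×-dec_; _⊎-dec_; decidable-stable)
open import Relation.Binary.PropositionalEquality using (refl; sym; trans; cong; subst; _≢_)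
open import Relation.Binary using (tri<; tri≈; tri>)
open import Function.Bundles using (Equivalence)

-- Let s_0 < … < s_{2m} be the positions of the non-accessory terms, c = s_{2m}.
-- (1) For any π: common out-neighbours in D(π) contribute to weights; if π
--     avoids 132, every non-accessory term lies in a 123 occurrence; and the
--     pattern lemma 'between-pairs': accessory terms between two increasing
--     pairs y<p, y′<p′ lying below-left of a common term are smaller than y,p,
--     larger than y′,p′, and decreasing.
-- (2) Star shape: weights are ≤ 1, edges contain the unique centre.  So the top
--     of every 123 occurrence is the centre (else all 2m+1 > 3 non-accessory
--     terms would lie in one occurrence), hence is c, and all other
--     non-accessory terms lie below-left of c.
-- (3) Alternation: s_0 is a left-to-right minimum, a minimum is followed by a
--     term with a smaller earlier term and vice versa; so each pair
--     (s_{2j}, s_{2j+1}) is increasing and 'between-pairs' gives the theorem.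

member⇒1≤length : ∀ {A : Set} {z : A} {xs : List A} → z ∈ xs → 1 ≤ length xs
member⇒1≤length (here _)  = s≤s z≤n
member⇒1≤length (there _) = s≤s z≤n

members⇒2≤length : ∀ {A : Set} {z₁ z₂ : A} {xs : List A} →
  z₁ ≢ z₂ → z₁ ∈ xs → z₂ ∈ xs → 2 ≤ length xs
members⇒2≤length z₁≢z₂ (here refl) (here refl) = ⊥-elim (z₁≢z₂ refl)
members⇒2≤length _     (here _)    (there z₂∈) = s≤s (member⇒1≤length z₂∈)
members⇒2≤length _     (there z₁∈) (here _)    = s≤s (member⇒1≤length z₁∈)
members⇒2≤length z₁≢z₂ (there z₁∈) (there z₂∈) =
  ℕP.m≤n⇒m≤1+n (members⇒2≤length z₁≢z₂ z₁∈ z₂∈)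

OneOf : {A : Set} → A → A → A → A → Set
OneOf u v w x = x ≡ u ⊎ x ≡ v ⊎ x ≡ w

module _ {A : Set} {u v w : A} where

  slot : ∀ {y} → OneOf u v w y → Fin 3
  slot (inj₁ _)        = fzero
  slot (inj₂ (inj₁ _)) = fsuc fzero
  slot (inj₂ (inj₂ _)) = fsuc (fsuc fzero)

  slot-faithful : ∀ {y y′} (p : OneOf u v w y) (q : OneOf u v w y′) → slot p ≡ slot q → y ≡ y′
  slot-faithful (inj₁ refl)        (inj₁ refl)        _  = refl
  slot-faithful (inj₂ (inj₁ refl)) (inj₂ (inj₁ refl)) _  = refl
  slot-faithful (inj₂ (inj₂ refl)) (inj₂ (inj₂ refl)) _  = refl
  slot-faithful (inj₁ _)           (inj₂ (inj₁ _))    ()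
  slot-faithful (inj₁ _)           (inj₂ (inj₂ _))    ()
  slot-faithful (inj₂ (inj₁ _))    (inj₁ _)           ()
  slot-faithful (inj₂ (inj₁ _))    (inj₂ (inj₂ _))    ()
  slot-faithful (inj₂ (inj₂ _))    (inj₁ _)           ()
  slot-faithful (inj₂ (inj₂ _))    (inj₂ (inj₁ _))    ()

  no-injection-into-three : ∀ {N} → 3 ℕ.< N →
    (x : Fin N → A) → (∀ i j → i < j → x i ≢ x j) → (∀ i → OneOf u v w (x i)) → ⊥
  no-injection-into-three 3<N x distinct inside
    with pigeonhole 3<N (λ i → slot (inside i))
  ... | i , j , i<j , same-slot = distinct i j i<j (slot-faithful (inside i) (inside j) same-slot)

_⋖_ : ∀ {N} → Fin N → Fin N → Set
a ⋖ b = toℕ b ≡ suc (toℕ a)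

⋖⇒< : ∀ {N} {a b : Fin N} → a ⋖ b → a < b
⋖⇒< {a = a} a⋖b = subst (toℕ a ℕ.<_) (sym a⋖b) ℕP.≤-refl

⋖-before : ∀ {N} {a b e : Fin N} → a ⋖ b → e < b → e ≡ a ⊎ e < a
⋖-before a⋖b e<b with ℕP.m≤n⇒m<n∨m≡n (ℕP.≤-pred (subst (_ ℕ.<_) a⋖b e<b))
... | inj₁ e<a = inj₂ e<a
... | inj₂ e≡a = inj₁ (FP.toℕ-injective e≡a)

⋖-after : ∀ {N} {a b e : Fin N} → a ⋖ b → a < e → e ≡ b ⊎ b < e
⋖-after {b = b} {e} a⋖b a<e with ℕP.m≤n⇒m<n∨m≡n (subst (ℕ._≤ toℕ e) (sym a⋖b) a<e)
... | inj₁ b<e = inj₂ b<e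
... | inj₂ b≡e = inj₁ (FP.toℕ-injective (sym b≡e))

predecessor : ∀ {N j} (b : Fin N) → toℕ b ≡ suc j → Σ (Fin N) λ a → toℕ a ≡ j × a ⋖ b
predecessor {N} {j} b b≡1+j = a , toℕ-a , trans b≡1+j (cong suc (sym toℕ-a))
  where
  j<N : j ℕ.< N
  j<N = ℕP.<-trans (ℕP.n<1+n j) (subst (ℕ._< N) b≡1+j (FP.toℕ<n b))
  a : Fin N
  a = fromℕ< j<N
  toℕ-a : toℕ a ≡ j
  toℕ-a = FP.toℕ-fromℕ< j<N

odd<double : ∀ {j m} → j ℕ.< m → 2 * j + 1 ℕ.< 2 * m
odd<double {j} {m} j<m = subst (ℕ._≤ 2 * m) 2[1+j]≡ (ℕP.*-monoʳ-≤ 2 j<m)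
  where
  2[1+j]≡ : 2 * suc j ≡ suc (2 * j + 1)
  2[1+j]≡ = trans (ℕP.*-suc 2 j) (cong suc (ℕP.+-comm 1 (2 * j)))

double-suc∸2 : ∀ i → 2 * suc i ∸ 2 ≡ 2 * i
double-suc∸2 i = cong (_∸ 2) (ℕP.*-suc 2 i)

double-suc∸1 : ∀ i → 2 * suc i ∸ 1 ≡ 2 * i + 1
double-suc∸1 i = trans (cong (_∸ 1) (ℕP.*-suc 2 i)) (ℕP.+-comm 1 (2 * i))

toℕ≤ : ∀ {k} (e : Fin (k + 1)) → toℕ e ≤ k
toℕ≤ {k} e = ℕP.≤-pred (subst (toℕ e ℕ.<_) (ℕP.+-comm k 1) (FP.toℕ<n e))

module _ {n : ℕ} (π : Fin n → Fin n) where

  arc-trans : ∀ {x y z} → Arc π y x → Arc π z y → Arc π z x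
  arc-trans (x<y , πx<πy) (y<z , πy<πz) = FP.<-trans x<y y<z , FP.<-trans πx<πy πy<πz

  CommonOut : Fin n → Fin n → Fin n → Set
  CommonOut z u v = Arc π u z × Arc π v z

  commonOut? : ∀ u v z → Dec (CommonOut z u v)
  commonOut? u v z = ((z <? u) ×-dec (π z <? π u)) ×-dec ((z <? v) ×-dec (π z <? π v))

  weight≥1 : ∀ {z u v} → CommonOut z u v → 1 ≤ weight π u v
  weight≥1 {z} {u} {v} common =
    member⇒1≤length (∈-filter⁺ (commonOut? u v) (∈-allFin z) common)

  weight≥2 : ∀ {z₁ z₂ u v} → z₁ ≢ z₂ → CommonOut z₁ u v → CommonOut z₂ u v → 2 ≤ weight π u v
  weight≥2 {z₁} {z₂} {u} {v} z₁≢z₂ common₁ common₂ = members⇒2≤length z₁≢z₂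
    (∈-filter⁺ (commonOut? u v) (∈-allFin z₁) common₁)
    (∈-filter⁺ (commonOut? u v) (∈-allFin z₂) common₂)

  Occ123 : Fin n → Fin n → Fin n → Set
  Occ123 a b d = Arc π b a × Arc π d b

  occurrence-common : ∀ {a b d} → Occ123 a b d → CommonOut a b d
  occurrence-common (ab , bd) = ab , arc-trans ab bd

  occurrence-nonaccessory : ∀ {a b d x} → Occ123 a b d → OneOf a b d x → ¬ Accessory π x
  occurrence-nonaccessory {a} {b} {d} ((a<b , πa<πb) , (b<d , πb<πd)) x∈ accessory =
    accessory (a , b , d , a<b , b<d , inj₁ (πa<πb , πb<πd) , x∈)

  HasOutNeighbour : Fin n → Set
  HasOutNeighbour x = Σ (Fin n) (Arc π x)

  hasOutNeighbour? : ∀ x → Dec (HasOutNeighbour x)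
  hasOutNeighbour? x = any? λ y → (y <? x) ×-dec (π y <? π x)

  LeftToRightMin : Fin n → Set
  LeftToRightMin x = ¬ HasOutNeighbour x

module Avoiding {n : ℕ} {π : Fin n → Fin n} (π-injective : IsPerm π) (avoids : Avoids132 π) where

  π-compare : ∀ {x y} → x ≢ y → π x < π y ⊎ π y < π x
  π-compare {x} {y} x≢y with FP.<-cmp (π x) (π y)
  ... | tri< πx<πy _ _ = inj₁ πx<πy
  ... | tri≈ _ πx≡πy _ = ⊥-elim (x≢y (π-injective πx≡πy))
  ... | tri> _ _ πy<πx = inj₂ πy<πx

  inOccurrence? : ∀ x → Dec (InOcc123or132 π x)
  inOccurrence? x = any? λ i → any? λ j → any? λ k →
    (i <? j) ×-dec ((j <? k) ×-dec
      ((((π i <? π j) ×-dec (π j <? π k)) ⊎-dec ((π i <? π k) ×-dec (π k <? π j)))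
        ×-dec ((x ≟ i) ⊎-dec ((x ≟ j) ⊎-dec (x ≟ k)))))

  occurrence-of : ∀ {x} → ¬ Accessory π x →
    Σ (Fin n) λ a → Σ (Fin n) λ b → Σ (Fin n) λ d → Occ123 π a b d × OneOf a b d x
  occurrence-of {x} nonaccessory with decidable-stable (inOccurrence? x) nonaccessory
  ... | a , b , d , a<b , b<d , inj₁ (πa<πb , πb<πd) , x∈ = a , b , d , ((a<b , πa<πb) , (b<d , πb<πd)) , x∈
  ... | a , b , d , a<b , b<d , inj₂ (πa<πd , πd<πb) , _ = ⊥-elim (avoids (a , b , d , a<b , b<d , πa<πd , πd<πb))

  between-pairs : ∀ {y p y′ p′ c} → Arc π p y → Arc π p′ y′ → Arc π c p → Arc π c p′ →
    (∀ k → Accessory π k → p < k → k < y′ →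
      π k < π y × π k < π p × π y′ < π k × π p′ < π k) ×
    (∀ k k′ → Accessory π k → Accessory π k′ → p < k → k < k′ → k′ < y′ → π k′ < π k)
  between-pairs {y} {p} {y′} {p′} {c} yp y′p′ pc p′c = squeezed , decreasing
    where
    -- Each of the four inequalities fails only by creating a 123 occurrence
    -- through k or a 132 occurrence.
    below-p : ∀ k → Accessory π k → p < k → π k < π p
    below-p k accessory p<k with π-compare (FP.<⇒≢ p<k)
    ... | inj₁ πp<πk = ⊥-elim (occurrence-nonaccessory π (yp , (p<k , πp<πk)) (inj₂ (inj₂ refl)) accessory)
    ... | inj₂ πk<πp = πk<πp

    squeezed : ∀ k → Accessory π k → p < k → k < y′ →
      π k < π y × π k < π p × π y′ < π k × π p′ < π k
    squeezed k accessory p<k k<y′ = below-y , πk<πp , above-y′ , above-p′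
      where
      πk<πp : π k < π p
      πk<πp = below-p k accessory p<k
      below-y : π k < π y
      below-y with π-compare (FP.<⇒≢ (FP.<-trans (proj₁ yp) p<k))
      ... | inj₂ πk<πy = πk<πy
      ... | inj₁ πy<πk = ⊥-elim (avoids (y , p , k , proj₁ yp , p<k , πy<πk , πk<πp))
      above-y′ : π y′ < π k
      above-y′ with π-compare (FP.<⇒≢ k<y′)
      ... | inj₂ πy′<πk = πy′<πk
      ... | inj₁ πk<πy′ = ⊥-elim (occurrence-nonaccessory π ((k<y′ , πk<πy′) , y′p′) (inj₁ refl) accessory)
      above-p′ : π p′ < π k
      above-p′ with π-compare (FP.<⇒≢ (FP.<-trans k<y′ (proj₁ y′p′)))
      ... | inj₂ πp′<πk = πp′<πk
      ... | inj₁ πk<πp′ = ⊥-elim (occurrence-nonaccessory π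
              ((FP.<-trans k<y′ (proj₁ y′p′) , πk<πp′) , p′c) (inj₁ refl) accessory)

    decreasing : ∀ k k′ → Accessory π k → Accessory π k′ → p < k → k < k′ → k′ < y′ → π k′ < π k
    decreasing k k′ accessory accessory′ p<k k<k′ k′<y′ with π-compare (FP.<⇒≢ k<k′)
    ... | inj₂ πk′<πk = πk′<πk
    ... | inj₁ πk<πk′ = ⊥-elim (occurrence-nonaccessory π
            ((k<k′ , πk<πk′) , (k′<c , FP.<-trans (below-p k′ accessory′ (FP.<-trans p<k k<k′)) (proj₂ pc)))
            (inj₁ refl) accessory)
      where
      k′<c : k′ < c
      k′<c = FP.<-trans k′<y′ (FP.<-trans (proj₁ y′p′) (proj₁ p′c))

module StarShape {n m : ℕ} {π : Fin n → Fin n} (star : WIsoStar π m) where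

  private
    f : Fin n → Fin n
    f = proj₁ (proj₂ star)

  IsCentre : Fin n → Set
  IsCentre x = toℕ (f x) ≡ 0

  centre-unique : ∀ {x y} → IsCentre x → IsCentre y → x ≡ y
  centre-unique x-centre y-centre =
    proj₁ (proj₂ (proj₂ star)) (FP.toℕ-injective (trans x-centre (sym y-centre)))

  weight≤1 : ∀ {u v} → u ≢ v → weight π u v ≤ 1
  weight≤1 {u} {v} u≢v with proj₂ (proj₂ (proj₂ star)) u v u≢v
  ... | inj₁ (_ , w≡1) = ℕP.≤-reflexive w≡1
  ... | inj₂ (_ , w≡0) = subst (_≤ 1) (sym w≡0) z≤n

  at-most-one-common : ∀ {z₁ z₂ u v} → u ≢ v → z₁ ≢ z₂ →
    CommonOut π z₁ u v → CommonOut π z₂ u v → ⊥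
  at-most-one-common u≢v z₁≢z₂ common₁ common₂ =
    ℕP.<⇒≱ (weight≥2 π z₁≢z₂ common₁ common₂) (weight≤1 u≢v)

  -- Two vertices with a common out-neighbour form an edge, which contains the centre.
  common⇒centre : ∀ {z u v} → u ≢ v → CommonOut π z u v → IsCentre u ⊎ IsCentre v
  common⇒centre {u = u} {v} u≢v common with proj₂ (proj₂ (proj₂ star)) u v u≢v
  ... | inj₁ (centre-leaf u-centre _ _ , _) = inj₁ u-centre
  ... | inj₁ (leaf-centre v-centre _ _ , _) = inj₂ v-centre
  ... | inj₂ (_ , w≡0) with subst (1 ≤_) w≡0 (weight≥1 π common)
  ...   | ()

module NonAccessoryTerms {n m : ℕ} (m≥2 : 2 ≤ m) {π : Fin n → Fin n} (inW : InWInvStar132 m π)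
  (s : Fin (2 * m + 1) → Fin n) (s-mono : ∀ a b → a < b → s a < s b)
  (s-enum : ∀ x → (¬ Accessory π x) ⇔ (∃ λ a → s a ≡ x)) where

  open Avoiding (proj₁ inW) (proj₁ (proj₂ inW))
  open StarShape (proj₂ (proj₂ inW))

  listed : ∀ {x} → ¬ Accessory π x → ∃ λ e → s e ≡ x
  listed {x} = Equivalence.to (s-enum x)

  enumerated : ∀ e → ¬ Accessory π (s e)
  enumerated e = Equivalence.from (s-enum (s e)) (e , refl)

  s-reflects : ∀ {a b} → s a < s b → a < b
  s-reflects {a} {b} sa<sb with FP.<-cmp a b
  ... | tri< a<b _ _ = a<b
  ... | tri≈ _ refl _ = ⊥-elim (FP.<-irrefl refl sa<sb)
  ... | tri> _ _ b<a = ⊥-elim (FP.<-asym sa<sb (s-mono b a b<a))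

  enumerated-before : ∀ {a b y} → a ⋖ b → ¬ Accessory π y → y < s b → y ≡ s a ⊎ y < s a
  enumerated-before a⋖b nonaccessory y<sb with listed nonaccessory
  ... | e , refl with ⋖-before a⋖b (s-reflects y<sb)
  ...   | inj₁ refl = inj₁ refl
  ...   | inj₂ e<a  = inj₂ (s-mono _ _ e<a)

  enumerated-after : ∀ {a b y} → a ⋖ b → ¬ Accessory π y → s a < y → y ≡ s b ⊎ s b < y
  enumerated-after a⋖b nonaccessory sa<y with listed nonaccessory
  ... | e , refl with ⋖-after a⋖b (s-reflects sa<y)
  ...   | inj₁ refl = inj₁ refl
  ...   | inj₂ b<e  = inj₂ (s-mono _ _ b<e)

  last : Fin (2 * m + 1)
  last = fromℕ< (ℕP.m<m+n (2 * m) (s≤s z≤n))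

  -- c = s_{2m}, the last non-accessory term; it turns out to be the centre.
  c : Fin n
  c = s last

  below-last : ∀ e → toℕ e ℕ.< 2 * m → s e < c
  below-last e e<2m = s-mono e last (subst (toℕ e ℕ.<_) (sym (FP.toℕ-fromℕ< _)) e<2m)

  nothing-after-c : ∀ {x} → ¬ Accessory π x → c < x → ⊥
  nothing-after-c nonaccessory c<x with listed nonaccessory
  ... | e , refl = ℕP.<⇒≱ (subst (ℕ._< toℕ e) (FP.toℕ-fromℕ< _) (s-reflects c<x)) (toℕ≤ e)

  -- If the middle term b of a 123 occurrence (a, b, d) were the centre, that
  -- occurrence would be the only one, so it would contain every non-accessory term.
  module MiddleCentre {a b d} (o : Occ123 π a b d) (b-centre : IsCentre b) where

    only-b : ∀ {x} → IsCentre x → x ≡ b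
    only-b x-centre = centre-unique x-centre b-centre

    -- The edge {b′, d′} contains b; if d′ = b, then b′ and d would be a
    -- centre-free edge with common out-neighbour a′.
    middle-is-b : ∀ {a′ b′ d′} → Occ123 π a′ b′ d′ → b′ ≡ b
    middle-is-b o′@(a′b′ , b′d′) with common⇒centre (FP.<⇒≢ (proj₁ b′d′)) (occurrence-common π o′)
    ... | inj₁ b′-centre = only-b b′-centre
    ... | inj₂ d′-centre with only-b d′-centre
    ...   | refl with common⇒centre (FP.<⇒≢ (proj₁ (arc-trans π b′d′ (proj₂ o))))
                         (occurrence-common π (a′b′ , arc-trans π b′d′ (proj₂ o)))
    ...     | inj₁ b′-centre = ⊥-elim (FP.<⇒≢ (proj₁ b′d′) (only-b b′-centre))
    ...     | inj₂ d-centre  = ⊥-elim (FP.<⇒≢ (proj₁ (proj₂ o)) (sym (only-b d-centre)))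

    -- Otherwise d′ and d would be a centre-free edge with common out-neighbour a.
    top-is-d : ∀ {a′ d′} → Occ123 π a′ b d′ → d′ ≡ d
    top-is-d {d′ = d′} (_ , bd′) with d′ ≟ d
    ... | yes d′≡d = d′≡d
    ... | no d′≢d with common⇒centre d′≢d (arc-trans π (proj₁ o) bd′ , proj₂ (occurrence-common π o))
    ...   | inj₁ d′-centre = ⊥-elim (FP.<⇒≢ (proj₁ bd′) (sym (only-b d′-centre)))
    ...   | inj₂ d-centre  = ⊥-elim (FP.<⇒≢ (proj₁ (proj₂ o)) (sym (only-b d-centre)))

    -- Otherwise b and d would have two common out-neighbours.
    bottom-is-a : ∀ {a′} → Occ123 π a′ b d → a′ ≡ a
    bottom-is-a {a′} o′ with a′ ≟ a
    ... | yes a′≡a = a′≡a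
    ... | no a′≢a = ⊥-elim (at-most-one-common (FP.<⇒≢ (proj₁ (proj₂ o))) a′≢a
                      (occurrence-common π o′) (occurrence-common π o))

    sole-occurrence : ∀ {x} → ¬ Accessory π x → OneOf a b d x
    sole-occurrence nonaccessory with occurrence-of nonaccessory
    ... | _ , _ , _ , o′ , x∈ with middle-is-b o′
    ...   | refl with top-is-d o′
    ...     | refl with bottom-is-a o′
    ...       | refl = x∈

  -- The top of every 123 occurrence is the centre: otherwise its middle term
  -- would be, and the 2m+1 > 3 non-accessory terms would fit in one occurrence.
  top-is-centre : ∀ {a b d} → Occ123 π a b d → IsCentre d
  top-is-centre o@(_ , bd) with common⇒centre (FP.<⇒≢ (proj₁ bd)) (occurrence-common π o)
  ... | inj₂ d-centre = d-centre
  ... | inj₁ b-centre = ⊥-elim (no-injection-into-three three<2m+1 s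
          (λ i j i<j → FP.<⇒≢ (s-mono i j i<j))
          (λ e → MiddleCentre.sole-occurrence o b-centre (enumerated e)))
    where
    three<2m+1 : 3 ℕ.< 2 * m + 1
    three<2m+1 = ℕP.<-≤-trans (ℕP.n<1+n 3) (ℕP.≤-trans (ℕP.*-monoʳ-≤ 2 m≥2) (ℕP.m≤m+n (2 * m) 1))

  occurrence-top : ∀ {a b d} → Occ123 π a b d → d ≡ c
  occurrence-top o with occurrence-of (enumerated last)
  ... | a′ , b′ , d′ , o′@(a′b′ , b′d′) , c∈ with centre-unique (top-is-centre o) (top-is-centre o′)
  ...   | refl with c∈
  ...     | inj₁ refl        = ⊥-elim (nothing-after-c (occurrence-nonaccessory π o′ (inj₂ (inj₂ refl)))
                                 (proj₁ (arc-trans π a′b′ b′d′)))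
  ...     | inj₂ (inj₁ refl) = ⊥-elim (nothing-after-c (occurrence-nonaccessory π o′ (inj₂ (inj₂ refl)))
                                 (proj₁ b′d′))
  ...     | inj₂ (inj₂ refl) = refl

  centred-occurrence : ∀ {x} → ¬ Accessory π x →
    Σ (Fin n) λ a → Σ (Fin n) λ b → Occ123 π a b c × OneOf a b c x
  centred-occurrence nonaccessory with occurrence-of nonaccessory
  ... | a , b , d , o , x∈ with occurrence-top o
  ...   | refl = a , b , o , x∈

  below-centre : ∀ e → toℕ e ℕ.< 2 * m → Arc π c (s e)
  below-centre e e<2m with centred-occurrence (enumerated e)
  ... | a , b , (ab , bc) , inj₁ refl        = arc-trans π ab bc
  ... | a , b , (ab , bc) , inj₂ (inj₁ refl) = bc
  ... | a , b , (ab , bc) , inj₂ (inj₂ se≡c) = ⊥-elim (FP.<⇒≢ (below-last e e<2m) se≡c)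

  s-step : ∀ {a b} → a ⋖ b → s a < s b
  s-step a⋖b = s-mono _ _ (⋖⇒< a⋖b)

  -- s_0 is a left-to-right minimum: a smaller earlier term would be a
  -- non-accessory term before s_0.
  first-minimum : ∀ e → toℕ e ≡ 0 → toℕ e ℕ.< 2 * m → LeftToRightMin π (s e)
  first-minimum e e≡0 e<2m (y , ye)
    with listed (occurrence-nonaccessory π (ye , below-centre e e<2m) (inj₁ refl))
  ... | e′ , refl with subst (toℕ e′ ℕ.<_) e≡0 (s-reflects (proj₁ ye))
  ...   | ()

  -- A left-to-right minimum s_a is followed by a term with a smaller earlier
  -- term.  s_a is the bottom of an occurrence (s_a, b′, c); if b′ ≠ s_b, then
  -- s_b < b′, and π(s_a) > π(s_b) would give b′ and c two common out-neighbours.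
  after-minimum : ∀ {a b} → a ⋖ b → toℕ b ℕ.< 2 * m →
    LeftToRightMin π (s a) → HasOutNeighbour π (s b)
  after-minimum {a} {b} a⋖b b<2m minimum = decidable-stable (hasOutNeighbour? π (s b)) refute
    where
    a<2m : toℕ a ℕ.< 2 * m
    a<2m = ℕP.<-trans (⋖⇒< a⋖b) b<2m

    refute : ¬ HasOutNeighbour π (s b) → ⊥
    refute none with centred-occurrence (enumerated a)
    ... | a′ , _ , (a′b′ , _) , inj₂ (inj₁ refl) = minimum (a′ , a′b′)
    ... | _  , _ , _ , inj₂ (inj₂ sa≡c) = FP.<⇒≢ (below-last a a<2m) sa≡c
    ... | _  , b′ , o@(a′b′ , b′c) , inj₁ refl
      with enumerated-after a⋖b (occurrence-nonaccessory π o (inj₂ (inj₁ refl))) (proj₁ a′b′)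
    ...   | inj₁ refl = none (s a , a′b′)
    ...   | inj₂ sb<b′ with π-compare (FP.<⇒≢ (s-step a⋖b))
    ...     | inj₁ πa<πb = none (s a , s-step a⋖b , πa<πb)
    ...     | inj₂ πb<πa = at-most-one-common (FP.<⇒≢ (proj₁ b′c)) (FP.<⇒≢ (s-step a⋖b))
                (a′b′ , below-centre a a<2m)
                ((sb<b′ , FP.<-trans πb<πa (proj₂ a′b′)) , below-centre b b<2m)

  -- A term s_a with an out-neighbour z is followed by a left-to-right minimum:
  -- if π(s_a) < π(s_b), then z and s_a are two common out-neighbours of s_b and
  -- c; otherwise a smaller earlier term y of s_b is non-accessory, so y = s_a
  -- (impossible) or y < s_a, and (y, s_a, s_b) is a 132 occurrence.
  after-non-minimum : ∀ {a b} → a ⋖ b → toℕ b ℕ.< 2 * m →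
    HasOutNeighbour π (s a) → LeftToRightMin π (s b)
  after-non-minimum {a} {b} a⋖b b<2m (z , za) (y , yb) with π-compare (FP.<⇒≢ (s-step a⋖b))
  ... | inj₁ πa<πb = at-most-one-common (FP.<⇒≢ (proj₁ (below-centre b b<2m))) (FP.<⇒≢ (proj₁ za))
          (occurrence-common π (arc-trans π za (s-step a⋖b , πa<πb) , below-centre b b<2m))
          (occurrence-common π ((s-step a⋖b , πa<πb) , below-centre b b<2m))
  ... | inj₂ πb<πa
    with enumerated-before a⋖b (occurrence-nonaccessory π (yb , below-centre b b<2m) (inj₁ refl)) (proj₁ yb)
  ...   | inj₁ refl = FP.<-asym (proj₂ yb) πb<πa
  ...   | inj₂ y<sa = proj₁ (proj₂ inW) (y , s a , s b , y<sa , s-step a⋖b , proj₂ yb , πb<πa)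

  -- A left-to-right minimum followed by a term with an out-neighbour z forms an
  -- increasing pair: z is non-accessory, so z = s_a, or z < s_a and then
  -- π(s_a) < π(z) by minimality.
  minimum-pair : ∀ {a b} → a ⋖ b → toℕ b ℕ.< 2 * m →
    LeftToRightMin π (s a) → HasOutNeighbour π (s b) → Arc π (s b) (s a)
  minimum-pair a⋖b b<2m minimum (z , zb)
    with enumerated-before a⋖b (occurrence-nonaccessory π (zb , below-centre _ b<2m) (inj₁ refl)) (proj₁ zb)
  ... | inj₁ refl = zb
  ... | inj₂ z<sa with π-compare (FP.<⇒≢ z<sa)
  ...   | inj₁ πz<πa = ⊥-elim (minimum (z , z<sa , πz<πa))
  ...   | inj₂ πa<πz = s-step a⋖b , FP.<-trans πa<πz (proj₂ zb)

  even-minimum : ∀ j e → toℕ e ≡ 2 * j → toℕ e ℕ.< 2 * m → LeftToRightMin π (s e)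
  even-minimum zero    e e≡0 e<2m = first-minimum e e≡0 e<2m
  even-minimum (suc j) e e≡ e<2m with predecessor e (trans e≡ (ℕP.*-suc 2 j))
  ... | d , d≡ , d⋖e with predecessor d d≡
  ...   | a , a≡ , a⋖d =
    after-non-minimum d⋖e e<2m (after-minimum a⋖d d<2m (even-minimum j a a≡ a<2m))
    where
    d<2m : toℕ d ℕ.< 2 * m
    d<2m = ℕP.<-trans (⋖⇒< d⋖e) e<2m
    a<2m : toℕ a ℕ.< 2 * m
    a<2m = ℕP.<-trans (⋖⇒< a⋖d) d<2m

  increasing-pair : ∀ j → j ℕ.< m → (y p : Fin (2 * m + 1)) →
    toℕ y ≡ 2 * j → toℕ p ≡ 2 * j + 1 → Arc π (s p) (s y) × Arc π c (s p)
  increasing-pair j j<m y p y≡ p≡ =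
    minimum-pair y⋖p p<2m minimum (after-minimum y⋖p p<2m minimum) , below-centre p p<2m
    where
    y⋖p : y ⋖ p
    y⋖p = trans p≡ (trans (ℕP.+-comm (2 * j) 1) (cong suc (sym y≡)))
    p<2m : toℕ p ℕ.< 2 * m
    p<2m = subst (ℕ._< 2 * m) (sym p≡) (odd<double j<m)
    minimum : LeftToRightMin π (s y)
    minimum = even-minimum j y y≡ (ℕP.<-trans (⋖⇒< y⋖p) p<2m)

mainTheorem13 : (n m : ℕ) → 2 ≤ m → (π : Fin n → Fin n) → InWInvStar132 m π →
    (s : Fin (2 * m + 1) → Fin n) →
    (∀ a b → a < b → s a < s b) →
    (∀ x → (¬ Accessory π x) ⇔ (∃ λ a → s a ≡ x)) →
    (i : ℕ) → 1 ≤ i → i Data.Nat.< m →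
    (yi pi yi′ pi′ : Fin (2 * m + 1)) →
    toℕ yi ≡ 2 * i ∸ 2 → toℕ pi ≡ 2 * i ∸ 1 → toℕ yi′ ≡ 2 * i → toℕ pi′ ≡ 2 * i + 1 →
    (∀ k → Accessory π k → s pi < k → k < s yi′ →
    π k < π (s yi) × π k < π (s pi) × π (s yi′) < π k × π (s pi′) < π k) ×
    (∀ k k′ → Accessory π k → Accessory π k′ → s pi < k → k < k′ → k′ < s yi′ →
    π k′ < π k)
mainTheorem13 n m m≥2 π inW s s-mono s-enum (suc i) _ 1+i<m yi pi yi′ pi′ yi≡ pi≡ yi′≡ pi′≡ =
  between-pairs (proj₁ pair) (proj₁ next-pair) (proj₂ pair) (proj₂ next-pair)
  where
  open Avoiding (proj₁ inW) (proj₁ (proj₂ inW))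
  open NonAccessoryTerms m≥2 inW s s-mono s-enum
  -- With the original i written as suc i, (yi, pi) = (s_{2i}, s_{2i+1}) and
  -- (yi′, pi′) = (s_{2i+2}, s_{2i+3}).
  pair : Arc π (s pi) (s yi) × Arc π c (s pi)
  pair = increasing-pair i (ℕP.<-trans (ℕP.n<1+n i) 1+i<m) yi pi
    (trans yi≡ (double-suc∸2 i)) (trans pi≡ (double-suc∸1 i))
  next-pair : Arc π (s pi′) (s yi′) × Arc π c (s pi′)
  next-pair = increasing-pair (suc i) 1+i<m yi′ pi′ yi′≡ pi′≡
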